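{- Every directed series-parallel graph $G$ is a laminar series-parallel graph.
   Context: All graphs are simple. A directed graph $G$ is a directed $s$-$t$-series-parallel graph ($s$-$t$-DSP) iff it is a single edge $st$, or it arises from the disjoint union of a directed $s_1$-$t_1$-series-parallel graph $G_1$ and a directed $s_2$-$t_2$-series-parallel graph $G_2$ by one of: (P-composition) identify $s_1$ with $s_2$ and $t_1$ with $t_2$, then $s=s_1,t=t_1$; (S-composition) identify $t_1$ with $s_2$, then $s=s_1,t=t_2$. A directed series-parallel graph (DSP) is an $s$-$t$-DSP for some $s,t$. For vertices $u,v$, $P_G(u,v)$ denotes the subgraph of $G$ induced by the edges on directed $u$-$v$-paths; for an edge $e=uv$ write $P_G(e)=P_G(u,v)$. A directed graph $G=(V,E)$ is a laminar series-parallel graph (LSP) iff (P1) for every $(s,t)\in V^2$, $P_G(s,t)$ is either an $s$-$t$-DSP or contains no edges; and (P2) for all edges $e_1,e_2\in E$, $P_G(e_1)\subseteq P_G(e_2)$ or $P_G(e_2)\subseteq P_G(e_1)$ or $E(P_G(e_1))\cap E(P_G(e_2))=\emptyset$. -}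

module Defs where

open import Data.Nat using (ℕ)
open import Data.Product using (Σ; ∃; _×_; _,_)
open import Data.Sum using (_⊎_)
open import Data.Empty using (⊥)
open import Data.List using (List; []; _∷_)
open import Data.List.Relation.Unary.Unique.Propositional using (Unique)
open import Relation.Binary.PropositionalEquality using (_≡_; _≢_)
open import Relation.Nullary using (¬_)

-- Being a relation, there are no multi-edges.
-- The vertex set of a graph is the set of endpoints of its edges (DSPs have no
-- isolated vertices).
Graph : Set₁
Graph = ℕ → ℕ → Set

Vert : Graph → ℕ → Set
Vert E x = ∃ λ w → E x w ⊎ E w x

_≐_ : Graph → Graph → Set
E ≐ F = ∀ u v → (E u v → F u v) × (F u v → E u v)

_⊆G_ : Graph → Graph → Set
E ⊆G F = ∀ u v → E u v → F u v

_∪G_ : Graph → Graph → Graph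
(E ∪G F) u v = E u v ⊎ F u v

Single : ℕ → ℕ → Graph
Single s t u v = (u ≡ s) × (v ≡ t)

-- The disjoint union followed by the
-- identification of terminals is realised concretely: G is the union of two
-- subgraphs G₁, G₂ whose vertex sets meet exactly in the identified vertices
-- (and, since all graphs are simple, the P-composition must not create
-- a parallel edge, i.e. G₁ and G₂ are edge-disjoint).
data IsDSP : Graph → ℕ → ℕ → Set₁ where
  edge : ∀ {E s t} → s ≢ t → E ≐ Single s t → IsDSP E s t
  par  : ∀ {E E₁ E₂ s t} → IsDSP E₁ s t → IsDSP E₂ s t →
         (∀ x → Vert E₁ x → Vert E₂ x → x ≡ s ⊎ x ≡ t) →
         (∀ u v → E₁ u v → E₂ u v → ⊥) →
         E ≐ (E₁ ∪G E₂) → IsDSP E s t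
  ser  : ∀ {E E₁ E₂ s m t} → IsDSP E₁ s m → IsDSP E₂ m t →
         (∀ x → Vert E₁ x → Vert E₂ x → x ≡ m) →
         E ≐ (E₁ ∪G E₂) → IsDSP E s t

DSP : Graph → Set₁
DSP E = Σ ℕ λ s → Σ ℕ λ t → IsDSP E s t

data Walk (E : Graph) : ℕ → ℕ → Set where
  []  : ∀ {u} → Walk E u u
  _∷_ : ∀ {u w v} → E u w → Walk E w v → Walk E u v

verts : ∀ {E u v} → Walk E u v → List ℕ
verts {u = u} []      = u ∷ []
verts {u = u} (_ ∷ p) = u ∷ verts p

data EdgeOn {E : Graph} : ∀ {u v} → Walk E u v → ℕ → ℕ → Set where
  here  : ∀ {u w v} (e : E u w) (p : Walk E w v) → EdgeOn (e ∷ p) u w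
  there : ∀ {u w v a b} (e : E u w) {p : Walk E w v} → EdgeOn p a b → EdgeOn (e ∷ p) a b

IsPath : ∀ {E u v} → Walk E u v → Set
IsPath p = Unique (verts p)

P : Graph → ℕ → ℕ → Graph
P G u v a b = G a b × Σ (Walk G u v) λ p → IsPath p × EdgeOn p a b

LSP : Graph → Set₁
LSP G =
  (∀ s t → Vert G s → Vert G t →
     IsDSP (P G s t) s t ⊎ (∀ a b → ¬ P G s t a b))
  ×
  (∀ a b c d → G a b → G c d →
     (P G a b ⊆G P G c d) ⊎ (P G c d ⊆G P G a b) ⊎
     (∀ x y → P G a b x y → P G c d x y → ⊥))

-- A DSP is acyclic, so every walk in it is a path and P_G(u,v) consists of the
-- edges lying on u-v-walks.  In a P-composition a walk never switches between the two
-- parts (they meet only in s and t), so P_G(u,v) is the union of the two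
-- P_Gᵢ(u,v), a P-composition again when both are non-empty.  In an
-- S-composition with middle terminal m a walk is a G₁-walk followed by a
-- G₂-walk, so P_G(u,v) is the S-composition of P_G₁(u,m) and P_G₂(m,v), or, if
-- one of these is empty, the union of P_G₁(u,v) and P_G₂(u,v).  For (P2), the
-- subgraph P_G(e) of an edge e other than st coincides with the one computed in
-- the part containing e, while P_G(s,t) contains every edge.
{-# OPTIONS --safe #-}
module Submission where

open import Defs
open import Data.Nat using (ℕ; _≟_)
open import Data.Product using (Σ; ∃; ∃₂; _×_; _,_; proj₁; proj₂)
open import Data.Sum using (_⊎_; inj₁; inj₂; swap; [_,_]′) renaming (map to map⊎)
open import Data.Empty using (⊥; ⊥-elim)
open import Data.List using ([]; _∷_)
open import Data.List.Relation.Unary.All as All using ()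
open import Data.List.Relation.Unary.AllPairs using ([]; _∷_)
open import Data.List.Relation.Unary.Any using () renaming (here to here∈; there to there∈)
open import Data.List.Membership.Propositional using (_∈_)
open import Function using (id)
open import Relation.Binary.PropositionalEquality using (_≡_; _≢_; refl; sym; trans; subst)
open import Relation.Nullary using (¬_; yes; no)
open import Relation.Nullary.Decidable using (_×-dec_)

≐-sym : ∀ {E F} → E ≐ F → F ≐ E
≐-sym E≐F u v = proj₂ (E≐F u v) , proj₁ (E≐F u v)

≐-trans : ∀ {E F H} → E ≐ F → F ≐ H → E ≐ H
≐-trans E≐F F≐H u v =
  (λ e → proj₁ (F≐H u v) (proj₁ (E≐F u v) e)) , (λ h → proj₂ (E≐F u v) (proj₂ (F≐H u v) h))

Empty : Graph → Set
Empty F = ∀ a b → ¬ F a b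

Disjoint : Graph → Graph → Set
Disjoint A B = ∀ x y → A x y → B x y → ⊥

Laminar : Graph → Graph → Set
Laminar A B = (A ⊆G B) ⊎ (B ⊆G A) ⊎ Disjoint A B

DSPorEmpty : Graph → ℕ → ℕ → Set₁
DSPorEmpty F u v = IsDSP F u v ⊎ Empty F

≐-∪-Emptyʳ : ∀ {F A B} → F ≐ (A ∪G B) → Empty B → F ≐ A
≐-∪-Emptyʳ F≐A∪B B-empty x y =
  (λ f → [ id , (λ b → ⊥-elim (B-empty x y b)) ]′ (proj₁ (F≐A∪B x y) f)) ,
  (λ a → proj₂ (F≐A∪B x y) (inj₁ a))

≐-∪-Emptyˡ : ∀ {F A B} → F ≐ (A ∪G B) → Empty A → F ≐ B
≐-∪-Emptyˡ F≐A∪B = ≐-∪-Emptyʳ λ x y →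
  (λ f → swap (proj₁ (F≐A∪B x y) f)) , (λ g → proj₂ (F≐A∪B x y) (swap g))

IsDSP-resp-≐ : ∀ {E F s t} → IsDSP E s t → E ≐ F → IsDSP F s t
IsDSP-resp-≐ (edge s≢t eq)        E≐F = edge s≢t (≐-trans (≐-sym E≐F) eq)
IsDSP-resp-≐ (par d₁ d₂ c dj eq) E≐F = par d₁ d₂ c dj (≐-trans (≐-sym E≐F) eq)
IsDSP-resp-≐ (ser d₁ d₂ c eq)    E≐F = ser d₁ d₂ c (≐-trans (≐-sym E≐F) eq)

DSPorEmpty-resp-≐ : ∀ {E F u v} → DSPorEmpty E u v → E ≐ F → DSPorEmpty F u v
DSPorEmpty-resp-≐ (inj₁ D)       E≐F = inj₁ (IsDSP-resp-≐ D E≐F)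
DSPorEmpty-resp-≐ (inj₂ E-empty) E≐F = inj₂ λ a b f → E-empty a b (proj₂ (E≐F a b) f)

Laminar-resp-≐ : ∀ {A A′ B B′} → A ≐ A′ → B ≐ B′ → Laminar A′ B′ → Laminar A B
Laminar-resp-≐ A≐ B≐ (inj₁ A⊆B) =
  inj₁ λ x y a → proj₂ (B≐ x y) (A⊆B x y (proj₁ (A≐ x y) a))
Laminar-resp-≐ A≐ B≐ (inj₂ (inj₁ B⊆A)) =
  inj₂ (inj₁ λ x y b → proj₂ (A≐ x y) (B⊆A x y (proj₁ (B≐ x y) b)))
Laminar-resp-≐ A≐ B≐ (inj₂ (inj₂ A∩B)) =
  inj₂ (inj₂ λ x y a b → A∩B x y (proj₁ (A≐ x y) a) (proj₁ (B≐ x y) b))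

∪-DSPorEmpty : ∀ {F A B u v} → F ≐ (A ∪G B) → DSPorEmpty A u v → DSPorEmpty B u v →
               (IsDSP A u v → IsDSP B u v → DSPorEmpty F u v) → DSPorEmpty F u v
∪-DSPorEmpty _ (inj₁ DA) (inj₁ DB) both = both DA DB
∪-DSPorEmpty F≐ (inj₁ DA) (inj₂ B-empty) _ = inj₁ (IsDSP-resp-≐ DA (≐-sym (≐-∪-Emptyʳ F≐ B-empty)))
∪-DSPorEmpty F≐ (inj₂ A-empty) (inj₁ DB) _ = inj₁ (IsDSP-resp-≐ DB (≐-sym (≐-∪-Emptyˡ F≐ A-empty)))
∪-DSPorEmpty F≐ (inj₂ A-empty) (inj₂ B-empty) _ =
  inj₂ λ x y f → [ A-empty x y , B-empty x y ]′ (proj₁ (F≐ x y) f)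

source-Vert : ∀ E {x w} → E x w → Vert E x
source-Vert E e = _ , inj₁ e

target-Vert : ∀ E {x w} → E w x → Vert E x
target-Vert E e = _ , inj₂ e

mapᵂ : ∀ {E F u v} → E ⊆G F → Walk E u v → Walk F u v
mapᵂ E⊆F []      = []
mapᵂ E⊆F (e ∷ p) = E⊆F _ _ e ∷ mapᵂ E⊆F p

EdgeOn-mapᵂ : ∀ {E F u v} (E⊆F : E ⊆G F) {p : Walk E u v} → EdgeOn p ⊆G EdgeOn (mapᵂ E⊆F p)
EdgeOn-mapᵂ E⊆F a b (here e p)  = here (E⊆F _ _ e) (mapᵂ E⊆F p)
EdgeOn-mapᵂ E⊆F a b (there e h) = there (E⊆F _ _ e) (EdgeOn-mapᵂ E⊆F a b h)

_++ᵂ_ : ∀ {E u w v} → Walk E u w → Walk E w v → Walk E u v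
[]      ++ᵂ q = q
(e ∷ p) ++ᵂ q = e ∷ (p ++ᵂ q)

EdgeOn-++ˡ : ∀ {E u w v} {p : Walk E u w} (q : Walk E w v) → EdgeOn p ⊆G EdgeOn (p ++ᵂ q)
EdgeOn-++ˡ q a b (here e p)  = here e (p ++ᵂ q)
EdgeOn-++ˡ q a b (there e h) = there e (EdgeOn-++ˡ q a b h)

EdgeOn-++ʳ : ∀ {E u w v} (p : Walk E u w) {q : Walk E w v} → EdgeOn q ⊆G EdgeOn (p ++ᵂ q)
EdgeOn-++ʳ []      a b h = h
EdgeOn-++ʳ (e ∷ p) a b h = there e (EdgeOn-++ʳ p a b h)

EdgeOn⇒edge : ∀ {E u v a b} {p : Walk E u v} → EdgeOn p a b → E a b
EdgeOn⇒edge (here e p)  = e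
EdgeOn⇒edge (there e h) = EdgeOn⇒edge h

last-edge : ∀ {E u w v} → E u w → Walk E w v → ∃ λ y → E y v
last-edge e []       = _ , e
last-edge e (e′ ∷ p) = last-edge e′ p

EdgeOn⇒first-edge : ∀ {E u v a b} {p : Walk E u v} → EdgeOn p a b → ∃ λ w → E u w
EdgeOn⇒first-edge (here e p)  = _ , e
EdgeOn⇒first-edge (there e h) = _ , e

EdgeOn⇒last-edge : ∀ {E u v a b} {p : Walk E u v} → EdgeOn p a b → ∃ λ w → E w v
EdgeOn⇒last-edge (here e p)  = last-edge e p
EdgeOn⇒last-edge (there e h) = EdgeOn⇒last-edge h

LiesIn : ∀ {E u v} → Graph → Walk E u v → Set
LiesIn {u = u} {v} A p = Σ (Walk A u v) λ q → EdgeOn p ⊆G EdgeOn q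

∷-LiesIn : ∀ {E A u w v} {e : E u w} {p : Walk E w v} → A u w → LiesIn A p → LiesIn A (e ∷ p)
∷-LiesIn a (q , p⊆q) = a ∷ q , λ where
  x y (here _ _)  → here a q
  x y (there _ h) → there a (p⊆q x y h)

walk-stays : ∀ {E A B : Graph} {x y v} → E ⊆G (A ∪G B) →
             (∀ {x y w} → A x y → ¬ B y w) → A x y → (p : Walk E y v) → LiesIn A p
walk-stays split no-switch a []      = [] , λ _ _ ()
walk-stays split no-switch a (e ∷ p) with split _ _ e
... | inj₁ a′ = ∷-LiesIn a′ (walk-stays split no-switch a′ p)
... | inj₂ b  = ⊥-elim (no-switch a b)

Pᵂ : Graph → ℕ → ℕ → Graph
Pᵂ G u v a b = Σ (Walk G u v) λ p → EdgeOn p a b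

Pᵂ⊆G : ∀ {G u v} → Pᵂ G u v ⊆G G
Pᵂ⊆G a b (p , h) = EdgeOn⇒edge h

Pᵂ-mono : ∀ {E F u v} → E ⊆G F → Pᵂ E u v ⊆G Pᵂ F u v
Pᵂ-mono E⊆F a b (p , h) = mapᵂ E⊆F p , EdgeOn-mapᵂ E⊆F a b h

Pᵂ-++ˡ : ∀ {E u w v a b} → Pᵂ E u w a b → Walk E w v → Pᵂ E u v a b
Pᵂ-++ˡ (p , h) q = p ++ᵂ q , EdgeOn-++ˡ q _ _ h

Pᵂ-++ʳ : ∀ {E u w v a b} → Walk E u w → Pᵂ E w v a b → Pᵂ E u v a b
Pᵂ-++ʳ p (q , h) = p ++ᵂ q , EdgeOn-++ʳ p _ _ h

Pᵂ-first-edge : ∀ {E u v a b} → Pᵂ E u v a b → ∃ λ w → E u w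
Pᵂ-first-edge (p , h) = EdgeOn⇒first-edge h

Pᵂ-last-edge : ∀ {E u v a b} → Pᵂ E u v a b → ∃ λ w → E w v
Pᵂ-last-edge (p , h) = EdgeOn⇒last-edge h

Vert-Pᵂ : ∀ {E u v x} → Vert (Pᵂ E u v) x → Vert E x
Vert-Pᵂ (w , inj₁ xw) = w , inj₁ (Pᵂ⊆G _ _ xw)
Vert-Pᵂ (w , inj₂ wx) = w , inj₂ (Pᵂ⊆G _ _ wx)

Acyclic : Graph → Set
Acyclic E = ∀ {x} → Empty (Pᵂ E x x)

prefix : ∀ {E w v y} (p : Walk E w v) → y ∈ verts p → Walk E w y
prefix []      (here∈ refl)  = []
prefix (e ∷ p) (here∈ refl)  = []
prefix (e ∷ p) (there∈ y∈p) = e ∷ prefix p y∈p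

Acyclic⇒IsPath : ∀ {E u v} → Acyclic E → (p : Walk E u v) → IsPath p
Acyclic⇒IsPath acyclic []      = All.[] ∷ []
Acyclic⇒IsPath acyclic (e ∷ p) =
  All.tabulate (λ y∈p u≡y → acyclic _ _ (e ∷ subst (Walk _ _) (sym u≡y) (prefix p y∈p) , here e _))
  ∷ Acyclic⇒IsPath acyclic p

P≐Pᵂ : ∀ {G} → Acyclic G → ∀ u v → P G u v ≐ Pᵂ G u v
P≐Pᵂ acyclic u v a b =
    (λ { (_ , p , _ , h) → p , h })
  , (λ { (p , h) → EdgeOn⇒edge h , p , Acyclic⇒IsPath acyclic p , h })

Single-ends : ∀ {E s t a b} → E ≐ Single s t → E a b → a ≡ s × b ≡ t
Single-ends eq e = proj₁ (eq _ _) e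

Single-no-2-walk : ∀ {E s t x y z} → s ≢ t → E ≐ Single s t → E x y → ¬ E y z
Single-no-2-walk s≢t eq xy yz =
  s≢t (trans (sym (proj₁ (Single-ends eq yz))) (proj₂ (Single-ends eq xy)))

Single-Pᵂ-empty : ∀ {E s t u v} → s ≢ t → E ≐ Single s t → ¬ (u ≡ s × v ≡ t) → Empty (Pᵂ E u v)
Single-Pᵂ-empty s≢t eq ¬st a b ([] , ())
Single-Pᵂ-empty s≢t eq ¬st a b (e ∷ [] , h)     = ¬st (Single-ends eq e)
Single-Pᵂ-empty s≢t eq ¬st a b (e ∷ e′ ∷ p , h) = Single-no-2-walk s≢t eq e e′

source-out : ∀ {E s t} → IsDSP E s t → ∃ λ w → E s w
source-out (edge _ eq)       = _ , proj₂ (eq _ _) (refl , refl)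
source-out (par d₁ _ _ _ eq) = _ , proj₂ (eq _ _) (inj₁ (proj₂ (source-out d₁)))
source-out (ser d₁ _ _ eq)   = _ , proj₂ (eq _ _) (inj₁ (proj₂ (source-out d₁)))

sink-in : ∀ {E s t} → IsDSP E s t → ∃ λ w → E w t
sink-in (edge _ eq)       = _ , proj₂ (eq _ _) (refl , refl)
sink-in (par d₁ _ _ _ eq) = _ , proj₂ (eq _ _) (inj₁ (proj₂ (sink-in d₁)))
sink-in (ser _ d₂ _ eq)   = _ , proj₂ (eq _ _) (inj₂ (proj₂ (sink-in d₂)))

source-no-in : ∀ {E s t} → IsDSP E s t → ∀ w → ¬ E w s
source-no-in (edge s≢t eq) w e = s≢t (proj₂ (Single-ends eq e))
source-no-in (par d₁ d₂ _ _ eq) w e =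
  [ source-no-in d₁ w , source-no-in d₂ w ]′ (proj₁ (eq w _) e)
source-no-in (ser {E₁ = E₁} {E₂ = E₂} d₁ d₂ c eq) w e with proj₁ (eq w _) e
... | inj₁ e₁ = source-no-in d₁ w e₁
... | inj₂ e₂ = source-no-in d₂ w (subst (E₂ w) s≡m e₂)
  where s≡m = c _ (source-Vert E₁ (proj₂ (source-out d₁))) (target-Vert E₂ e₂)

sink-no-out : ∀ {E s t} → IsDSP E s t → ∀ w → ¬ E t w
sink-no-out (edge s≢t eq) w e = s≢t (sym (proj₁ (Single-ends eq e)))
sink-no-out (par d₁ d₂ _ _ eq) w e =
  [ sink-no-out d₁ w , sink-no-out d₂ w ]′ (proj₁ (eq _ w) e)
sink-no-out (ser {E₁ = E₁} {E₂ = E₂} d₁ d₂ c eq) w e with proj₁ (eq _ w) e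
... | inj₁ e₁ = sink-no-out d₁ w (subst (λ z → E₁ z w) t≡m e₁)
  where t≡m = c _ (source-Vert E₁ e₁) (target-Vert E₂ (proj₂ (sink-in d₂)))
... | inj₂ e₂ = sink-no-out d₂ w e₂

IsDSP⇒∃edge : ∀ {F u v} → IsDSP F u v → ∃₂ F
IsDSP⇒∃edge D = _ , _ , proj₂ (source-out D)

Pᵂ-source-out : ∀ {F u v} → IsDSP (Pᵂ F u v) u v → ∃ λ w → F u w
Pᵂ-source-out D = _ , Pᵂ⊆G _ _ (proj₂ (source-out D))

Pᵂ-sink-in : ∀ {F u v} → IsDSP (Pᵂ F u v) u v → ∃ λ w → F w v
Pᵂ-sink-in D = _ , Pᵂ⊆G _ _ (proj₂ (sink-in D))

PᵂLaminar : Graph → Set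
PᵂLaminar E = ∀ a b c d → E a b → E c d → Laminar (Pᵂ E a b) (Pᵂ E c d)

PᵂInPart : Graph → Graph → Graph → ℕ → ℕ → Set
PᵂInPart E E₁ E₂ a b = (E₁ a b × Pᵂ E a b ≐ Pᵂ E₁ a b) ⊎ (E₂ a b × Pᵂ E a b ≐ Pᵂ E₂ a b)

PᵂLaminar-parts : ∀ {E E₁ E₂ a b c d} → Disjoint E₁ E₂ → PᵂLaminar E₁ → PᵂLaminar E₂ →
                  PᵂInPart E E₁ E₂ a b → PᵂInPart E E₁ E₂ c d → Laminar (Pᵂ E a b) (Pᵂ E c d)
PᵂLaminar-parts _ lam₁ _ (inj₁ (ab , ≐ab)) (inj₁ (cd , ≐cd)) =
  Laminar-resp-≐ ≐ab ≐cd (lam₁ _ _ _ _ ab cd)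
PᵂLaminar-parts _ _ lam₂ (inj₂ (ab , ≐ab)) (inj₂ (cd , ≐cd)) =
  Laminar-resp-≐ ≐ab ≐cd (lam₂ _ _ _ _ ab cd)
PᵂLaminar-parts disjoint _ _ (inj₁ (_ , ≐ab)) (inj₂ (_ , ≐cd)) =
  inj₂ (inj₂ λ x y h h′ → disjoint x y (Pᵂ⊆G x y (proj₁ (≐ab x y) h)) (Pᵂ⊆G x y (proj₁ (≐cd x y) h′)))
PᵂLaminar-parts disjoint _ _ (inj₂ (_ , ≐ab)) (inj₁ (_ , ≐cd)) =
  inj₂ (inj₂ λ x y h h′ → disjoint x y (Pᵂ⊆G x y (proj₁ (≐cd x y) h′)) (Pᵂ⊆G x y (proj₁ (≐ab x y) h)))

module Union {E E₁ E₂ : Graph} (eq : E ≐ (E₁ ∪G E₂)) where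

  split₁₂ : E ⊆G (E₁ ∪G E₂)
  split₁₂ u w = proj₁ (eq u w)

  split₂₁ : E ⊆G (E₂ ∪G E₁)
  split₂₁ u w e = swap (split₁₂ u w e)

  E₁⊆E : E₁ ⊆G E
  E₁⊆E u w e = proj₂ (eq u w) (inj₁ e)

  E₂⊆E : E₂ ⊆G E
  E₂⊆E u w e = proj₂ (eq u w) (inj₂ e)

  Pᵂ-∪⊆ : ∀ {u v} → (Pᵂ E₁ u v ∪G Pᵂ E₂ u v) ⊆G Pᵂ E u v
  Pᵂ-∪⊆ x y = [ Pᵂ-mono E₁⊆E x y , Pᵂ-mono E₂⊆E x y ]′

module Parallel {E E₁ E₂ : Graph} {s t : ℕ} (d₁ : IsDSP E₁ s t) (d₂ : IsDSP E₂ s t)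
                (common : ∀ x → Vert E₁ x → Vert E₂ x → x ≡ s ⊎ x ≡ t)
                (eq : E ≐ (E₁ ∪G E₂)) where

  open Union eq public

  no-switch₁₂ : ∀ {x y w} → E₁ x y → ¬ E₂ y w
  no-switch₁₂ {y = y} xy yw with common y (target-Vert E₁ xy) (source-Vert E₂ yw)
  ... | inj₁ refl = source-no-in d₁ _ xy
  ... | inj₂ refl = sink-no-out d₂ _ yw

  no-switch₂₁ : ∀ {x y w} → E₂ x y → ¬ E₁ y w
  no-switch₂₁ {y = y} xy yw with common y (source-Vert E₁ yw) (target-Vert E₂ xy)
  ... | inj₁ refl = source-no-in d₂ _ xy
  ... | inj₂ refl = sink-no-out d₁ _ yw

  shared-out⇒source : ∀ {a w w′} → E₁ a w → E₂ a w′ → a ≡ s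
  shared-out⇒source {a} e₁ e₂ with common a (source-Vert E₁ e₁) (source-Vert E₂ e₂)
  ... | inj₁ a≡s = a≡s
  ... | inj₂ refl = ⊥-elim (sink-no-out d₁ _ e₁)

  shared-in⇒sink : ∀ {b w w′} → E₁ w b → E₂ w′ b → b ≡ t
  shared-in⇒sink {b} e₁ e₂ with common b (target-Vert E₁ e₁) (target-Vert E₂ e₂)
  ... | inj₁ refl = ⊥-elim (source-no-in d₁ _ e₁)
  ... | inj₂ b≡t = b≡t

  walk-in-one-part : ∀ {u v} (p : Walk E u v) → LiesIn E₁ p ⊎ LiesIn E₂ p
  walk-in-one-part []      = inj₁ ([] , λ _ _ ())
  walk-in-one-part (e ∷ p) with split₁₂ _ _ e
  ... | inj₁ e₁ = inj₁ (∷-LiesIn e₁ (walk-stays split₁₂ no-switch₁₂ e₁ p))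
  ... | inj₂ e₂ = inj₂ (∷-LiesIn e₂ (walk-stays split₂₁ no-switch₂₁ e₂ p))

  Pᵂ-split : ∀ u v → Pᵂ E u v ≐ (Pᵂ E₁ u v ∪G Pᵂ E₂ u v)
  Pᵂ-split u v x y = to , Pᵂ-∪⊆ x y
    where
    to : Pᵂ E u v x y → (Pᵂ E₁ u v ∪G Pᵂ E₂ u v) x y
    to (p , h) with walk-in-one-part p
    ... | inj₁ (q , p⊆q) = inj₁ (q , p⊆q x y h)
    ... | inj₂ (q , p⊆q) = inj₂ (q , p⊆q x y h)

  Pᵂ₂-empty : ∀ {a b} → ¬ (a ≡ s × b ≡ t) → E₁ a b → Empty (Pᵂ E₂ a b)
  Pᵂ₂-empty ¬st ab x y h =
    ¬st ( shared-out⇒source ab (proj₂ (Pᵂ-first-edge h))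
        , shared-in⇒sink ab (proj₂ (Pᵂ-last-edge h)))

  Pᵂ₁-empty : ∀ {a b} → ¬ (a ≡ s × b ≡ t) → E₂ a b → Empty (Pᵂ E₁ a b)
  Pᵂ₁-empty ¬st ab x y h =
    ¬st ( shared-out⇒source (proj₂ (Pᵂ-first-edge h)) ab
        , shared-in⇒sink (proj₂ (Pᵂ-last-edge h)) ab)

  Acyclic-par : Acyclic E₁ → Acyclic E₂ → Acyclic E
  Acyclic-par acyclic₁ acyclic₂ x y h =
    [ acyclic₁ x y , acyclic₂ x y ]′ (proj₁ (Pᵂ-split _ _ x y) h)

  Pᵂ-par : ∀ {u v} → Disjoint E₁ E₂ → IsDSP (Pᵂ E₁ u v) u v → IsDSP (Pᵂ E₂ u v) u v →
           IsDSP (Pᵂ E u v) u v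
  Pᵂ-par disjoint D₁ D₂
    with shared-out⇒source (proj₂ (Pᵂ-source-out D₁)) (proj₂ (Pᵂ-source-out D₂))
       | shared-in⇒sink (proj₂ (Pᵂ-sink-in D₁)) (proj₂ (Pᵂ-sink-in D₂))
  ... | refl | refl =
    par D₁ D₂ (λ x x∈₁ x∈₂ → common x (Vert-Pᵂ x∈₁) (Vert-Pᵂ x∈₂))
              (λ x y h₁ h₂ → disjoint x y (Pᵂ⊆G x y h₁) (Pᵂ⊆G x y h₂))
              (Pᵂ-split _ _)

  Pᵂ-in-part : ∀ {a b} → ¬ (a ≡ s × b ≡ t) → E a b → PᵂInPart E E₁ E₂ a b
  Pᵂ-in-part ¬st ab with split₁₂ _ _ ab
  ... | inj₁ ab₁ = inj₁ (ab₁ , ≐-∪-Emptyʳ (Pᵂ-split _ _) (Pᵂ₂-empty ¬st ab₁))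
  ... | inj₂ ab₂ = inj₂ (ab₂ , ≐-∪-Emptyˡ (Pᵂ-split _ _) (Pᵂ₁-empty ¬st ab₂))

module Series {E E₁ E₂ : Graph} {s m t : ℕ} (d₁ : IsDSP E₁ s m) (d₂ : IsDSP E₂ m t)
              (common : ∀ x → Vert E₁ x → Vert E₂ x → x ≡ m)
              (eq : E ≐ (E₁ ∪G E₂)) where

  open Union eq public

  no-switch : ∀ {x y w} → E₂ x y → ¬ E₁ y w
  no-switch {y = y} xy yw with common y (source-Vert E₁ yw) (target-Vert E₂ xy)
  ... | refl = sink-no-out d₁ _ yw

  no-shared-out : ∀ {a w w′} → E₁ a w → ¬ E₂ a w′
  no-shared-out {a} e₁ e₂ with common a (source-Vert E₁ e₁) (source-Vert E₂ e₂)
  ... | refl = sink-no-out d₁ _ e₁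

  no-shared-in : ∀ {b w w′} → E₁ w b → ¬ E₂ w′ b
  no-shared-in {b} e₁ e₂ with common b (target-Vert E₁ e₁) (target-Vert E₂ e₂)
  ... | refl = source-no-in d₂ _ e₂

  disjoint : Disjoint E₁ E₂
  disjoint x y = no-shared-out

  Split : ∀ {u v} → Walk E u v → Set
  Split {u} {v} p = ∃ λ z → Σ (Walk E₁ u z) λ p₁ → Σ (Walk E₂ z v) λ p₂ →
                    EdgeOn p ⊆G (EdgeOn p₁ ∪G EdgeOn p₂)

  walk-split : ∀ {u v} (p : Walk E u v) → Split p
  walk-split []      = _ , [] , [] , λ _ _ ()
  walk-split (e ∷ p) with split₁₂ _ _ e
  ... | inj₂ e₂ = let (q , ep⊆q) = ∷-LiesIn e₂ (walk-stays split₂₁ no-switch e₂ p)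
                  in _ , [] , q , λ x y h → inj₂ (ep⊆q x y h)
  ... | inj₁ e₁ with walk-split p
  ...   | z , p₁ , p₂ , p⊆p₁p₂ = z , e₁ ∷ p₁ , p₂ , λ where
    x y (here _ _)  → inj₁ (here e₁ p₁)
    x y (there _ h) → map⊎ (there e₁) id (p⊆p₁p₂ x y h)

  PᵂCases : ℕ → ℕ → Graph
  PᵂCases u v x y = Pᵂ E₁ u v x y ⊎ Pᵂ E₂ u v x y ⊎
                    (∃₂ (Pᵂ E₁ u m) × ∃₂ (Pᵂ E₂ m v) × (Pᵂ E₁ u m ∪G Pᵂ E₂ m v) x y)

  Pᵂ-trichotomy : ∀ {u v} → Pᵂ E u v ⊆G PᵂCases u v
  Pᵂ-trichotomy x y (p , h) with walk-split p
  ... | _ , p₁ , p₂ , p⊆p₁p₂ = classify p₁ p₂ (p⊆p₁p₂ x y h)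
    where
    classify : ∀ {u v z} (p₁ : Walk E₁ u z) (p₂ : Walk E₂ z v) →
               (EdgeOn p₁ ∪G EdgeOn p₂) x y → PᵂCases u v x y
    classify []        p₂        (inj₁ ())
    classify []        p₂        (inj₂ h₂) = inj₂ (inj₁ (p₂ , h₂))
    classify p₁        []        (inj₁ h₁) = inj₁ (p₁ , h₁)
    classify (e₁ ∷ k₁) []        (inj₂ ())
    classify {z = z} (e₁ ∷ k₁) (e₂ ∷ k₂) h₁₂
      with common z (target-Vert E₁ (proj₂ (last-edge e₁ k₁))) (source-Vert E₂ e₂)
    ... | refl = inj₂ (inj₂ ( (_ , _ , e₁ ∷ k₁ , here e₁ k₁) , (_ , _ , e₂ ∷ k₂ , here e₂ k₂)
                            , map⊎ (e₁ ∷ k₁ ,_) (e₂ ∷ k₂ ,_) h₁₂))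

  Acyclic-ser : Acyclic E₁ → Acyclic E₂ → Acyclic E
  Acyclic-ser acyclic₁ acyclic₂ x y h with Pᵂ-trichotomy _ _ h
  ... | inj₁ h₁ = acyclic₁ x y h₁
  ... | inj₂ (inj₁ h₂) = acyclic₂ x y h₂
  ... | inj₂ (inj₂ ((_ , _ , h₁) , (_ , _ , h₂) , _)) =
    no-switch (proj₂ (Pᵂ-last-edge h₂)) (proj₂ (Pᵂ-first-edge h₁))

  Pᵂ-through-m : ∀ {u v} → ∃₂ (Pᵂ E₁ u m) → ∃₂ (Pᵂ E₂ m v) →
                 Pᵂ E u v ≐ (Pᵂ E₁ u m ∪G Pᵂ E₂ m v)
  Pᵂ-through-m (_ , _ , h₁) (_ , _ , h₂) x y = to , from
    where
    to : Pᵂ E _ _ x y → (Pᵂ E₁ _ m ∪G Pᵂ E₂ m _) x y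
    to h with Pᵂ-trichotomy _ _ h
    ... | inj₁ g₁ =
      ⊥-elim (no-shared-in (proj₂ (Pᵂ-last-edge g₁)) (proj₂ (Pᵂ-last-edge h₂)))
    ... | inj₂ (inj₁ g₂) =
      ⊥-elim (no-shared-out (proj₂ (Pᵂ-first-edge h₁)) (proj₂ (Pᵂ-first-edge g₂)))
    ... | inj₂ (inj₂ (_ , _ , g)) = g
    from : (Pᵂ E₁ _ m ∪G Pᵂ E₂ m _) x y → Pᵂ E _ _ x y
    from (inj₁ g₁) = Pᵂ-++ˡ (Pᵂ-mono E₁⊆E x y g₁) (mapᵂ E₂⊆E (proj₁ h₂))
    from (inj₂ g₂) = Pᵂ-++ʳ (mapᵂ E₁⊆E (proj₁ h₁)) (Pᵂ-mono E₂⊆E x y g₂)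

  Pᵂ-avoiding-m : ∀ {u v} → Empty (Pᵂ E₁ u m) ⊎ Empty (Pᵂ E₂ m v) →
                  Pᵂ E u v ≐ (Pᵂ E₁ u v ∪G Pᵂ E₂ u v)
  Pᵂ-avoiding-m avoid x y = to , Pᵂ-∪⊆ x y
    where
    to : Pᵂ E _ _ x y → (Pᵂ E₁ _ _ ∪G Pᵂ E₂ _ _) x y
    to h with Pᵂ-trichotomy _ _ h
    ... | inj₁ g₁ = inj₁ g₁
    ... | inj₂ (inj₁ g₂) = inj₂ g₂
    ... | inj₂ (inj₂ ((_ , _ , g₁) , (_ , _ , g₂) , _)) =
      ⊥-elim ([ (λ empty₁ → empty₁ _ _ g₁) , (λ empty₂ → empty₂ _ _ g₂) ]′ avoid)

  Pᵂ-edge₁ : ∀ {a b} → E₁ a b → Pᵂ E a b ≐ Pᵂ E₁ a b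
  Pᵂ-edge₁ ab x y = to , Pᵂ-mono E₁⊆E x y
    where
    to : Pᵂ E _ _ x y → Pᵂ E₁ _ _ x y
    to h with Pᵂ-trichotomy _ _ h
    ... | inj₁ g₁ = g₁
    ... | inj₂ (inj₁ g₂) = ⊥-elim (no-shared-out ab (proj₂ (Pᵂ-first-edge g₂)))
    ... | inj₂ (inj₂ (_ , (_ , _ , g₂) , _)) = ⊥-elim (no-shared-in ab (proj₂ (Pᵂ-last-edge g₂)))

  Pᵂ-edge₂ : ∀ {a b} → E₂ a b → Pᵂ E a b ≐ Pᵂ E₂ a b
  Pᵂ-edge₂ ab x y = to , Pᵂ-mono E₂⊆E x y
    where
    to : Pᵂ E _ _ x y → Pᵂ E₂ _ _ x y
    to h with Pᵂ-trichotomy _ _ h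
    ... | inj₁ g₁ = ⊥-elim (no-shared-in (proj₂ (Pᵂ-last-edge g₁)) ab)
    ... | inj₂ (inj₁ g₂) = g₂
    ... | inj₂ (inj₂ ((_ , _ , g₁) , _)) = ⊥-elim (no-shared-out (proj₂ (Pᵂ-first-edge g₁)) ab)

  Pᵂ-in-part : ∀ {a b} → E a b → PᵂInPart E E₁ E₂ a b
  Pᵂ-in-part ab = map⊎ (λ ab₁ → ab₁ , Pᵂ-edge₁ ab₁) (λ ab₂ → ab₂ , Pᵂ-edge₂ ab₂) (split₁₂ _ _ ab)

  Pᵂ-avoiding-m-DSPorEmpty : ∀ {u v} → Empty (Pᵂ E₁ u m) ⊎ Empty (Pᵂ E₂ m v) →
                             DSPorEmpty (Pᵂ E₁ u v) u v → DSPorEmpty (Pᵂ E₂ u v) u v →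
                             DSPorEmpty (Pᵂ E u v) u v
  Pᵂ-avoiding-m-DSPorEmpty avoid P₁ P₂ = ∪-DSPorEmpty (Pᵂ-avoiding-m avoid) P₁ P₂ λ D₁ D₂ →
    ⊥-elim (no-shared-out (proj₂ (Pᵂ-source-out D₁)) (proj₂ (Pᵂ-source-out D₂)))

  Pᵂ-ser : ∀ {u v} → DSPorEmpty (Pᵂ E₁ u m) u m → DSPorEmpty (Pᵂ E₂ m v) m v →
           DSPorEmpty (Pᵂ E₁ u v) u v → DSPorEmpty (Pᵂ E₂ u v) u v → DSPorEmpty (Pᵂ E u v) u v
  Pᵂ-ser (inj₁ D₁) (inj₁ D₂) _ _ =
    inj₁ (ser D₁ D₂ (λ x x∈₁ x∈₂ → common x (Vert-Pᵂ x∈₁) (Vert-Pᵂ x∈₂))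
                    (Pᵂ-through-m (IsDSP⇒∃edge D₁) (IsDSP⇒∃edge D₂)))
  Pᵂ-ser (inj₂ empty₁) _ P₁ P₂ = Pᵂ-avoiding-m-DSPorEmpty (inj₁ empty₁) P₁ P₂
  Pᵂ-ser (inj₁ _) (inj₂ empty₂) P₁ P₂ = Pᵂ-avoiding-m-DSPorEmpty (inj₂ empty₂) P₁ P₂

IsDSP⇒Acyclic : ∀ {E s t} → IsDSP E s t → Acyclic E
IsDSP⇒Acyclic (edge s≢t eq) = Single-Pᵂ-empty s≢t eq λ (x≡s , x≡t) → s≢t (trans (sym x≡s) x≡t)
IsDSP⇒Acyclic (par d₁ d₂ c _ eq) =
  Parallel.Acyclic-par d₁ d₂ c eq (IsDSP⇒Acyclic d₁) (IsDSP⇒Acyclic d₂)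
IsDSP⇒Acyclic (ser d₁ d₂ c eq) =
  Series.Acyclic-ser d₁ d₂ c eq (IsDSP⇒Acyclic d₁) (IsDSP⇒Acyclic d₂)

IsDSP⇒⊆Pᵂ : ∀ {E s t} → IsDSP E s t → E ⊆G Pᵂ E s t
IsDSP⇒⊆Pᵂ (edge _ eq) a b ab with Single-ends eq ab
... | refl , refl = ab ∷ [] , here ab []
IsDSP⇒⊆Pᵂ (par d₁ d₂ _ _ eq) a b ab =
  Pᵂ-∪⊆ a b (map⊎ (IsDSP⇒⊆Pᵂ d₁ a b) (IsDSP⇒⊆Pᵂ d₂ a b) (split₁₂ a b ab))
  where open Union eq
IsDSP⇒⊆Pᵂ (ser d₁ d₂ _ eq) a b ab =
  [ (λ ab₁ → Pᵂ-++ˡ (Pᵂ-mono E₁⊆E a b (IsDSP⇒⊆Pᵂ d₁ a b ab₁)) (mapᵂ E₂⊆E (terminal-walk d₂)))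
  , (λ ab₂ → Pᵂ-++ʳ (mapᵂ E₁⊆E (terminal-walk d₁)) (Pᵂ-mono E₂⊆E a b (IsDSP⇒⊆Pᵂ d₂ a b ab₂)))
  ]′ (split₁₂ a b ab)
  where
  open Union eq
  terminal-walk : ∀ {F u v} → IsDSP F u v → Walk F u v
  terminal-walk D = proj₁ (IsDSP⇒⊆Pᵂ D _ _ (proj₂ (source-out D)))

IsDSP⇒≐Pᵂ : ∀ {E s t} → IsDSP E s t → E ≐ Pᵂ E s t
IsDSP⇒≐Pᵂ D a b = IsDSP⇒⊆Pᵂ D a b , Pᵂ⊆G a b

Pᵂ⊆Pᵂ-terminals : ∀ {E s t u v} → IsDSP E s t → Pᵂ E u v ⊆G Pᵂ E s t
Pᵂ⊆Pᵂ-terminals D x y h = IsDSP⇒⊆Pᵂ D x y (Pᵂ⊆G x y h)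

Pᵂ-DSPorEmpty : ∀ {E s t} → IsDSP E s t → ∀ u v → DSPorEmpty (Pᵂ E u v) u v
Pᵂ-DSPorEmpty {s = s} {t} D@(edge s≢t eq) u v with (u ≟ s) ×-dec (v ≟ t)
... | yes (refl , refl) = inj₁ (IsDSP-resp-≐ D (IsDSP⇒≐Pᵂ D))
... | no ¬st            = inj₂ (Single-Pᵂ-empty s≢t eq ¬st)
Pᵂ-DSPorEmpty (par d₁ d₂ c disjoint eq) u v =
  ∪-DSPorEmpty (Pᵂ-split u v) (Pᵂ-DSPorEmpty d₁ u v) (Pᵂ-DSPorEmpty d₂ u v)
    λ D₁ D₂ → inj₁ (Pᵂ-par disjoint D₁ D₂)
  where open Parallel d₁ d₂ c eq
Pᵂ-DSPorEmpty (ser d₁ d₂ c eq) u v =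
  Series.Pᵂ-ser d₁ d₂ c eq (Pᵂ-DSPorEmpty d₁ u _) (Pᵂ-DSPorEmpty d₂ _ v)
                           (Pᵂ-DSPorEmpty d₁ u v) (Pᵂ-DSPorEmpty d₂ u v)

Pᵂ-laminar : ∀ {E s t} → IsDSP E s t → PᵂLaminar E
Pᵂ-laminar (edge _ eq) a b c d ab cd with Single-ends eq ab | Single-ends eq cd
... | refl , refl | refl , refl = inj₁ λ _ _ h → h
Pᵂ-laminar {s = s} {t} D@(par d₁ d₂ cm disjoint eq) a b c d ab cd
  with (a ≟ s) ×-dec (b ≟ t) | (c ≟ s) ×-dec (d ≟ t)
... | yes (refl , refl) | _                 = inj₂ (inj₁ (Pᵂ⊆Pᵂ-terminals D))
... | no _              | yes (refl , refl) = inj₁ (Pᵂ⊆Pᵂ-terminals D)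
... | no ¬st₁ | no ¬st₂ =
  PᵂLaminar-parts disjoint (Pᵂ-laminar d₁) (Pᵂ-laminar d₂) (Pᵂ-in-part ¬st₁ ab) (Pᵂ-in-part ¬st₂ cd)
  where open Parallel d₁ d₂ cm eq
Pᵂ-laminar (ser d₁ d₂ cm eq) a b c d ab cd =
  PᵂLaminar-parts disjoint (Pᵂ-laminar d₁) (Pᵂ-laminar d₂) (Pᵂ-in-part ab) (Pᵂ-in-part cd)
  where open Series d₁ d₂ cm eq

theorem5 : (G : Graph) → DSP G → LSP G
theorem5 G (s , t , D) = P1 , P2
  where
  P≐ : ∀ u v → P G u v ≐ Pᵂ G u v
  P≐ = P≐Pᵂ (IsDSP⇒Acyclic D)

  P1 : ∀ u v → Vert G u → Vert G v → DSPorEmpty (P G u v) u v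
  P1 u v _ _ = DSPorEmpty-resp-≐ (Pᵂ-DSPorEmpty D u v) (≐-sym (P≐ u v))

  P2 : ∀ a b c d → G a b → G c d → Laminar (P G a b) (P G c d)
  P2 a b c d ab cd = Laminar-resp-≐ (P≐ a b) (P≐ c d) (Pᵂ-laminar D a b c d ab cd)
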